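{- Let $n\geq 2$ and let $D_n\subseteq\mathbb{Q}^n$ be topologically dense with no two distinct points colinear. Then $(D_n,<)$, with $<$ the product order, is not ultrahomogeneous.
   Context: The product order on $\mathbb{Q}^n$: $\mathbf{a}<\mathbf{b}$ iff $a_i\leq b_i$ for all $i$ and $\mathbf{a}\neq\mathbf{b}$. Colinear means sharing a coordinate. A structure is ultrahomogeneous if every isomorphism between finite substructures extends to an automorphism of the whole structure. -}

module Defs where

open import Data.Nat using (ℕ)
open import Data.Fin using (Fin)
open import Data.Vec using (Vec; lookup)
open import Data.Rational using (ℚ; _≤_; _<_)
open import Data.Product using (Σ; ∃; _×_; proj₁)
open import Relation.Binary.PropositionalEquality using (_≡_; _≢_)
open import Relation.Nullary using (¬_)
open import Relation.Unary using (Pred; _∈_)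
open import Level using (0ℓ)

Point : ℕ → Set
Point n = Vec ℚ n

_<ₚ_ : ∀ {n} → Point n → Point n → Set
a <ₚ b = (∀ i → lookup a i ≤ lookup b i) × (a ≢ b)

Colinear : ∀ {n} → Point n → Point n → Set
Colinear a b = ∃ λ i → lookup a i ≡ lookup b i

-- Topologically dense in ℚ^n (product topology): every nonempty open box
-- contains a point of D (open boxes form a base of the topology).
TopDense : ∀ {n} → Pred (Point n) 0ℓ → Set
TopDense {n} D =
  (a b : Point n) → (∀ i → lookup a i < lookup b i) →
  ∃ λ d → d ∈ D × (∀ i → (lookup a i < lookup d i) × (lookup d i < lookup b i))

NoTwoColinear : ∀ {n} → Pred (Point n) 0ℓ → Set
NoTwoColinear {n} D =
  (a b : Point n) → a ∈ D → b ∈ D → a ≢ b → ¬ Colinear a b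

Elem : ∀ {n} → Pred (Point n) 0ℓ → Set
Elem {n} D = Σ (Point n) (λ x → x ∈ D)

module _ {n : ℕ} (D : Pred (Point n) 0ℓ) where

  _≈D_ : Elem D → Elem D → Set
  x ≈D y = proj₁ x ≡ proj₁ y

  _<D_ : Elem D → Elem D → Set
  x <D y = proj₁ x <ₚ proj₁ y

  -- An isomorphism between finite substructures of (D,<): the domain is
  -- enumerated without repetition as dom 0..k-1 and dom i ↦ cod i.
  record FinPartialIso : Set where
    field
      k       : ℕ
      dom     : Fin k → Elem D
      cod     : Fin k → Elem D
      dom-inj : ∀ i j → dom i ≈D dom j → i ≡ j
      cod-inj : ∀ i j → cod i ≈D cod j → i ≡ j
      pres    : ∀ i j → dom i <D dom j → cod i <D cod j
      refl'   : ∀ i j → cod i <D cod j → dom i <D dom j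

  record Automorphism : Set where
    field
      to       : Elem D → Elem D
      from     : Elem D → Elem D
      to-cong  : ∀ x y → x ≈D y → to x ≈D to y
      from-cong : ∀ x y → x ≈D y → from x ≈D from y
      from-to  : ∀ x → from (to x) ≈D x
      to-from  : ∀ y → to (from y) ≈D y
      pres     : ∀ x y → x <D y → to x <D to y
      refl'    : ∀ x y → to x <D to y → x <D y

  Extends : Automorphism → FinPartialIso → Set
  Extends σ f = ∀ i → Automorphism.to σ (FinPartialIso.dom f i) ≈D FinPartialIso.cod f i

  Ultrahomogeneous : Set
  Ultrahomogeneous = (f : FinPartialIso) → Σ Automorphism (λ σ → Extends σ f)

-- Choose, by density, points a, b, c of D forming an antichain, with b
-- between a and c in the first two coordinates and below a in all others.
-- Then every strict upper bound of a and c lies strictly above b, whereas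
-- some point d of D lies above b and c but not above a.  The partial
-- isomorphism swapping a and b and fixing c cannot extend to an
-- automorphism σ: e = σ⁻¹ d is above a and c, hence above b, so
-- d = σ e is above σ b = a.
module Submission where

open import Defs
open import Data.Nat using (ℕ; _≥_; suc; s≤s)
open import Data.Fin using (Fin; zero; suc)
import Data.Fin as Fin
open import Data.Fin.Properties using (<-cmp)
open import Data.Fin.Permutation using (Permutation′; _⟨$⟩ʳ_; transpose)
open import Data.Vec using (lookup; tabulate)
open import Data.Vec.Properties using (lookup∘tabulate)
open import Data.Integer using (+_)
open import Data.Rational using (ℚ; 1ℚ; _/_; _+_; _<_; _≤_)
open import Data.Rational.Properties
  using (_≤?_; <⇒≤; ≤-trans; <-≤-trans; <-trans; <-irrefl; +-monoʳ-<; +-identityʳ; positive⁻¹)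
open import Data.Product using (Σ; _×_; _,_; proj₁; proj₂)
open import Data.Sum using (_⊎_; inj₁; inj₂)
open import Data.Empty using (⊥-elim)
open import Function using (_∘_)
open import Function.Bundles using (Injection)
open import Function.Properties.Inverse using (↔⇒↣)
open import Level using (0ℓ)
open import Relation.Binary.Definitions using (tri<; tri≈; tri>)
open import Relation.Binary.PropositionalEquality using (_≡_; _≢_; refl; sym; subst; subst₂)
open import Relation.Nullary using (¬_)
open import Relation.Nullary.Decidable using (True; toWitness)
open import Relation.Unary using (Pred)

≤-by-evaluation : {p q : ℚ} → {True (p ≤? q)} → p ≤ q
≤-by-evaluation {p} {q} {p≤q} = toWitness {a? = p ≤? q} p≤q

p<p+1 : (p : ℚ) → p < p + 1ℚ
p<p+1 p = subst (_< p + 1ℚ) (+-identityʳ p) (+-monoʳ-< p (positive⁻¹ 1ℚ))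

<ₚ-irrefl : ∀ {n} {p : Point n} → ¬ p <ₚ p
<ₚ-irrefl (_ , p≢p) = p≢p refl

<-coordinate⇒≢ : ∀ {n} {p q : Point n} i → lookup p i < lookup q i → p ≢ q
<-coordinate⇒≢ i pᵢ<qᵢ refl = <-irrefl refl pᵢ<qᵢ

>-coordinate⇒≮ₚ : ∀ {n} {p q : Point n} i → lookup q i < lookup p i → ¬ p <ₚ q
>-coordinate⇒≮ₚ i qᵢ<pᵢ (p≤q , _) = <-irrefl refl (<-≤-trans qᵢ<pᵢ (p≤q i))

<-everywhere⇒<ₚ : ∀ {n} {p q : Point (suc n)} → (∀ i → lookup p i < lookup q i) → p <ₚ q
<-everywhere⇒<ₚ p<q = (λ i → <⇒≤ (p<q i)) , <-coordinate⇒≢ zero (p<q zero)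

below-join : ∀ {n} {a b c e : Point n} →
  (∀ i → lookup b i ≤ lookup a i ⊎ lookup b i ≤ lookup c i) →
  ∀ j → lookup b j < lookup c j → a <ₚ e → c <ₚ e → b <ₚ e
below-join {b = b} {e = e} b≤a∨c j bⱼ<cⱼ (a≤e , _) (c≤e , _) =
  b≤e , <-coordinate⇒≢ j (<-≤-trans bⱼ<cⱼ (c≤e j))
  where
  b≤e : ∀ i → lookup b i ≤ lookup e i
  b≤e i with b≤a∨c i
  ... | inj₁ bᵢ≤aᵢ = ≤-trans bᵢ≤aᵢ (a≤e i)
  ... | inj₂ bᵢ≤cᵢ = ≤-trans bᵢ≤cᵢ (c≤e i)

record InUnitBox {n} (v : Fin n → ℚ) (p : Point n) : Set where
  constructor unit-box
  field
    above : ∀ i → v i < lookup p i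
    below : ∀ i → lookup p i < v i + 1ℚ

unit-boxes-separated : ∀ {n} {v w : Fin n → ℚ} {p q : Point n} → InUnitBox v p → InUnitBox w q →
  ∀ i → v i + 1ℚ ≤ w i → lookup p i < lookup q i
unit-boxes-separated p∈v q∈w i vᵢ+1≤wᵢ =
  <-trans (<-≤-trans (InUnitBox.below p∈v i) vᵢ+1≤wᵢ) (InUnitBox.above q∈w i)

module _ {n : ℕ} {D : Pred (Point n) 0ℓ} where

  dense-in-unit-box : TopDense D → (v : Fin n → ℚ) → Σ (Elem D) (InUnitBox v ∘ proj₁)
  dense-in-unit-box dense v with dense (tabulate v) (tabulate (λ i → v i + 1ℚ)) v<v+1
    where
    v<v+1 : ∀ i → lookup (tabulate v) i < lookup (tabulate (λ i → v i + 1ℚ)) i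
    v<v+1 i = subst₂ _<_ (sym (lookup∘tabulate v i)) (sym (lookup∘tabulate _ i)) (p<p+1 (v i))
  ... | x , x∈D , x∈box = (x , x∈D) , unit-box
    (λ i → subst (_< lookup x i) (lookup∘tabulate v i) (proj₁ (x∈box i)))
    (λ i → subst (lookup x i <_) (lookup∘tabulate _ i) (proj₂ (x∈box i)))

  record IsAntichain {k : ℕ} (pts : Fin k → Elem D) : Set where
    field
      injective    : ∀ i j → _≈D_ D (pts i) (pts j) → i ≡ j
      incomparable : ∀ i j → ¬ _<D_ D (pts i) (pts j)

  permute-antichain : ∀ {k} {pts : Fin k → Elem D} → IsAntichain pts → Permutation′ k → FinPartialIso D
  permute-antichain {k} {pts} antichain π = record
    { k       = k
    ; dom     = pts
    ; cod     = pts ∘ (π ⟨$⟩ʳ_)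
    ; dom-inj = injective
    ; cod-inj = λ i j eq → Injection.injective (↔⇒↣ π) (injective _ _ eq)
    ; pres    = λ i j pᵢ<pⱼ → ⊥-elim (incomparable i j pᵢ<pⱼ)
    ; refl'   = λ i j πpᵢ<πpⱼ → ⊥-elim (incomparable _ _ πpᵢ<πpⱼ)
    }
    where open IsAntichain antichain

  Staircase : ∀ {k} → Fin n → Fin n → (Fin k → Elem D) → Set
  Staircase x y pts = ∀ {i j} → i Fin.< j →
    lookup (proj₁ (pts i)) x < lookup (proj₁ (pts j)) x ×
    lookup (proj₁ (pts j)) y < lookup (proj₁ (pts i)) y

  staircase⇒antichain : ∀ {k} {x y} {pts : Fin k → Elem D} → Staircase x y pts → IsAntichain pts
  staircase⇒antichain {x = x} {y} {pts} stairs = record { injective = injective ; incomparable = incomparable }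
    where
    injective : ∀ i j → _≈D_ D (pts i) (pts j) → i ≡ j
    injective i j eq with <-cmp i j
    ... | tri< i<j _ _ = ⊥-elim (<-coordinate⇒≢ x (proj₁ (stairs i<j)) eq)
    ... | tri≈ _ i≡j _ = i≡j
    ... | tri> _ _ j<i = ⊥-elim (<-coordinate⇒≢ x (proj₁ (stairs j<i)) (sym eq))

    incomparable : ∀ i j → ¬ _<D_ D (pts i) (pts j)
    incomparable i j with <-cmp i j
    ... | tri< i<j _ _ = >-coordinate⇒≮ₚ y (proj₂ (stairs i<j))
    ... | tri≈ _ refl _ = <ₚ-irrefl
    ... | tri> _ _ j<i = >-coordinate⇒≮ₚ x (proj₁ (stairs j<i))

  swapped-below-join : (σ : Automorphism D) → let open Automorphism σ in
    ∀ a b c d → _≈D_ D (to a) b → _≈D_ D (to b) a → _≈D_ D (to c) c →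
    (∀ e → _<D_ D a e → _<D_ D c e → _<D_ D b e) →
    _<D_ D b d → _<D_ D c d → _<D_ D a d
  swapped-below-join σ a b c d σa≈b σb≈a σc≈c b-below-join b<d c<d =
    subst₂ _<ₚ_ σb≈a σe≈d (pres b e (b-below-join e a<e c<e))
    where
    open Automorphism σ
    e : Elem D
    e = from d
    σe≈d : _≈D_ D (to e) d
    σe≈d = to-from d
    a<e : _<D_ D a e
    a<e = refl' a e (subst₂ _<ₚ_ (sym σa≈b) (sym σe≈d) b<d)
    c<e : _<D_ D c e
    c<e = refl' c e (subst₂ _<ₚ_ (sym σc≈c) (sym σe≈d) c<d)

corner : ∀ {n} → ℕ → ℕ → Fin (suc n) → ℚ
corner x y zero    = + x / 1
corner x y (suc _) = + y / 1

module Configuration (m : ℕ) {D : Pred (Point (suc (suc m))) 0ℓ} (dense : TopDense D) where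

  near : (x y : ℕ) → Σ (Elem D) (InUnitBox (corner x y) ∘ proj₁)
  near x y = dense-in-unit-box dense (corner x y)

  a b c d : Elem D
  a = proj₁ (near 0 4)
  b = proj₁ (near 2 2)
  c = proj₁ (near 4 0)
  d = proj₁ (near 6 3)

  a-box : InUnitBox (corner 0 4) (proj₁ a)
  a-box = proj₂ (near 0 4)
  b-box : InUnitBox (corner 2 2) (proj₁ b)
  b-box = proj₂ (near 2 2)
  c-box : InUnitBox (corner 4 0) (proj₁ c)
  c-box = proj₂ (near 4 0)
  d-box : InUnitBox (corner 6 3) (proj₁ d)
  d-box = proj₂ (near 6 3)

  abc : Fin 3 → Elem D
  abc zero             = a
  abc (suc zero)       = b
  abc (suc (suc zero)) = c

  abc-staircase : Staircase zero (suc zero) abc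
  abc-staircase {zero} {suc zero} _ =
    unit-boxes-separated a-box b-box zero ≤-by-evaluation ,
    unit-boxes-separated b-box a-box (suc zero) ≤-by-evaluation
  abc-staircase {zero} {suc (suc zero)} _ =
    unit-boxes-separated a-box c-box zero ≤-by-evaluation ,
    unit-boxes-separated c-box a-box (suc zero) ≤-by-evaluation
  abc-staircase {suc zero} {suc (suc zero)} _ =
    unit-boxes-separated b-box c-box zero ≤-by-evaluation ,
    unit-boxes-separated c-box b-box (suc zero) ≤-by-evaluation
  abc-staircase {zero} {zero} ()
  abc-staircase {suc zero} {zero} ()
  abc-staircase {suc zero} {suc zero} (s≤s ())
  abc-staircase {suc (suc zero)} {zero} ()
  abc-staircase {suc (suc zero)} {suc zero} (s≤s ())
  abc-staircase {suc (suc zero)} {suc (suc zero)} (s≤s (s≤s ()))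

  b<c₀ : lookup (proj₁ b) zero < lookup (proj₁ c) zero
  b<c₀ = unit-boxes-separated b-box c-box zero ≤-by-evaluation

  b-below-join-a-c : ∀ e → _<D_ D a e → _<D_ D c e → _<D_ D b e
  b-below-join-a-c _ = below-join b≤a∨c zero b<c₀
    where
    b≤a∨c : ∀ i → lookup (proj₁ b) i ≤ lookup (proj₁ a) i ⊎ lookup (proj₁ b) i ≤ lookup (proj₁ c) i
    b≤a∨c zero    = inj₂ (<⇒≤ b<c₀)
    b≤a∨c (suc i) = inj₁ (<⇒≤ (unit-boxes-separated b-box a-box (suc i) ≤-by-evaluation))

  b<d : _<D_ D b d
  b<d = <-everywhere⇒<ₚ λ where
    zero    → unit-boxes-separated b-box d-box zero ≤-by-evaluation
    (suc i) → unit-boxes-separated b-box d-box (suc i) ≤-by-evaluation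

  c<d : _<D_ D c d
  c<d = <-everywhere⇒<ₚ λ where
    zero    → unit-boxes-separated c-box d-box zero ≤-by-evaluation
    (suc i) → unit-boxes-separated c-box d-box (suc i) ≤-by-evaluation

  a≮d : ¬ _<D_ D a d
  a≮d = >-coordinate⇒≮ₚ (suc zero) (unit-boxes-separated d-box a-box (suc zero) ≤-by-evaluation)

proposition2p4 : (n : ℕ) → n ≥ 2 → (D : Pred (Point n) 0ℓ) →
    TopDense D → NoTwoColinear D → ¬ Ultrahomogeneous D
proposition2p4 (suc (suc m)) (s≤s (s≤s _)) D dense _ ultrahomogeneous =
  a≮d (swapped-below-join σ a b c d
         (σ-extends zero) (σ-extends (suc zero)) (σ-extends (suc (suc zero)))
         b-below-join-a-c b<d c<d)
  where
  open Configuration m dense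
  swap-a-b : FinPartialIso D
  swap-a-b = permute-antichain (staircase⇒antichain {pts = abc} abc-staircase)
                               (transpose zero (suc zero))
  σ : Automorphism D
  σ = proj₁ (ultrahomogeneous swap-a-b)
  σ-extends : Extends D σ swap-a-b
  σ-extends = proj₂ (ultrahomogeneous swap-a-b)
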